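{- Let $p>2$ be a prime and let $k$ be a divisor of $p-1$ with $1<k<p/2$. Put $r_0(k)=\left\lfloor\frac{\log(p/2)}{\log k}\right\rfloor$ and $s=s_0(k,k)=\max\left\{s'\in\mathbb{Z}_{\ge0}~:~\binom{r_0(k)+s'}{s'}\le k\right\}$. Then $$\sum_{h\mid k}T((p-1)/h,p)\le\#X(k,p)\le\Psi(k,p_{s}).$$
   Context: For a positive divisor $d$ of $p-1$ and $k=(p-1)/d$ define $X^*(k,p)=\{x\in\mathbb{Z}~:~1\le x\le k,\ (x,k)=1,\ x^k\equiv(-k)^k\pmod p\}$, $X(k,p)=\{x\in\mathbb{Z}~:~1\le x\le k,\ x^k\equiv(-k)^k\pmod p\}$, and $T(d,p)=\#X^*(k,p)$; $(x,k)$ is the greatest common divisor. $\Psi(x,y)$ is the number of positive integers $n\le x$ all of whose prime factors are at most $y$; $p_j$ is the $j$-th prime ($p_1=2$), with the convention $\Psi(x,p_0)=1$ for $x\ge1$. -}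

module Defs where

open import Data.Nat as ℕ using (ℕ; zero; suc; _+_; _*_; _∸_; _^_; _≤_; s≤s)
open import Data.Nat.DivMod using (_/_)
open import Data.Nat.GCD using (gcd)
open import Data.Nat.Primality using (Prime; prime?)
open import Data.Nat.Divisibility using (_∣?_; _∣_; ∣⇒≤)
open import Data.Nat.Properties using (allUpTo?)
open import Data.Integer as ℤ using (ℤ; +_)
open import Data.Integer.Divisibility as ℤD using ()
open import Data.List using (List; length; filter; map; upTo)
open import Data.Nat.ListAction using (sum)
open import Data.Product using (_×_)
open import Relation.Binary.PropositionalEquality using (_≡_)
open import Relation.Nullary using (Dec; yes; no)
open import Relation.Nullary.Decidable using (_×-dec_; _→-dec_)
import Level
open import Relation.Unary using (Pred; Decidable)

range1 : ℕ → List ℕ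
range1 n = map suc (upTo n)

countUpTo : {P : Pred ℕ Level.zero} → Decidable P → ℕ → ℕ
countUpTo P? n = length (filter P? (range1 n))

_≡_[mod_] : ℤ → ℤ → ℕ → Set
a ≡ b [mod p ] = (+ p) ℤD.∣ (a ℤ.- b)

≡mod? : (a b : ℤ) (p : ℕ) → Dec (a ≡ b [mod p ])
≡mod? a b p = p ∣? ℤ.∣ a ℤ.- b ∣

Cong : ℕ → ℕ → ℕ → Set
Cong k p x = ((+ x) ℤ.^ k) ≡ ((ℤ.- (+ k)) ℤ.^ k) [mod p ]

Cong? : (k p : ℕ) → Decidable (Cong k p)
Cong? k p x = ≡mod? ((+ x) ℤ.^ k) ((ℤ.- (+ k)) ℤ.^ k) p

Xcard : ℕ → ℕ → ℕ
Xcard k p = countUpTo (Cong? k p) k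

XstarPred : ℕ → ℕ → Pred ℕ Level.zero
XstarPred k p x = (gcd x k ≡ 1) × Cong k p x

Xstar? : (k p : ℕ) → Decidable (XstarPred k p)
Xstar? k p x = (gcd x k ℕ.≟ 1) ×-dec Cong? k p x

Xstarcard : ℕ → ℕ → ℕ
Xstarcard k p = countUpTo (Xstar? k p) k

-- natural-number division, total (d = 0 gives 0; never used at d = 0)
divℕ : ℕ → ℕ → ℕ
divℕ m zero = zero
divℕ m (suc d) = m / suc d

T : ℕ → ℕ → ℕ
T d p = Xstarcard (divℕ (p ∸ 1) d) p

divisors : ℕ → List ℕ
divisors k = filter (_∣? k) (range1 k)

sumT : ℕ → ℕ → ℕ
sumT k p = sum (map (λ h → T (divℕ (p ∸ 1) h) p) (divisors k))

primeCount : ℕ → ℕ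
primeCount q = countUpTo prime? q

-- n is p_s-smooth: every prime factor q of n satisfies q ≤ p_s,
-- expressed as π(q) ≤ s (for prime q, q ≤ p_s ⇔ π(q) ≤ s); for s = 0
-- only n = 1 qualifies, matching the convention Ψ(x,p_0) = 1.
Smooth : ℕ → ℕ → Set
Smooth s n = (q : ℕ) → Prime q → q ∣ n → primeCount q ≤ s

private
  SmQ : ℕ → ℕ → Pred ℕ Level.zero
  SmQ s n q = Prime q → q ∣ n → primeCount q ≤ s

  SmQ? : (s n : ℕ) → Decidable (SmQ s n)
  SmQ? s n q = (prime? q) →-dec ((q ∣? n) →-dec (primeCount q ℕ.≤? s))

Smooth? : (s n : ℕ) → Dec (Smooth s (suc n))
Smooth? s n with allUpTo? (SmQ? s (suc n)) (suc (suc n))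
... | yes f = yes (λ q pq q∣ → f (s≤s (∣⇒≤ q∣)) pq q∣)
... | no ¬f = no (λ sm → ¬f (λ {q} _ → sm q))

-- Ψ(x, p_s) = #{1 ≤ n ≤ x : every prime factor of n is ≤ p_s}
Ψ : ℕ → ℕ → ℕ
Ψ x s = length (filter (Smooth? s) (upTo x))

-- For the first inequality, (h , x) ↦ x · (k / h) maps the pairs with h ∣ k and
-- x ∈ X*(h, p) injectively into X(k, p); the gcd of the image with k recovers k / h.
--
-- For the second, separate the solutions a ∈ X(k, p) ⊆ [1, k] by their q-adic
-- valuations at the primes q = 2, 3, 5, … in turn.  A prime q branches for a if some
-- solution c agreeing with a at all smaller primes has ν_q(c) ≠ ν_q(a).  If
-- q₁ < … < q_t are the branching primes of a, with such witnesses c₁, …, c_t, then the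
-- C(r₀ + t, t) monomials of degree r₀ in a, c₁, …, c_t are distinct (compare their
-- valuations at the qᵢ), are at most k^r₀ < p, and all satisfy y^k ≡ (-k)^(k r₀) mod p.
-- A monic polynomial of degree k has at most k roots modulo p, so C(r₀ + t, t) ≤ k and
-- t ≤ s.  Finally a ↦ ∏ pᵢ^ν_{qᵢ}(a) is injective, since two solutions first differ at a
-- common branching prime, and it maps X(k, p) to p_s-smooth numbers in [1, k].

module Submission where

open import Defs
open import Data.Nat.Base as ℕ using (ℕ; zero; suc; z≤n; s≤s)
open import Data.Nat.Primality using (Prime; prime?; euclidsLemma; prime⇒nonTrivial; prime⇒irreducible)
open import Data.Nat.Combinatorics using (_C_; nCn≡1; nCk+nC[k+1]≡[n+1]C[k+1])
open import Data.List.Base using (List; []; _∷_; length; map; filter; upTo; _++_; [_])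
open import Data.List.Properties
  using (length-map; map-cong-local; length-++; map-++; upTo-∷ʳ; filter-++; filter-accept; filter-reject)
open import Data.List.Membership.Propositional using (_∈_; find)
open import Data.List.Membership.Propositional.Properties
  using (∈-∃++; ∈-++⁻; ∈-map⁺; ∈-map⁻; ∈-upTo⁺; ∈-upTo⁻; ∈-filter⁺; ∈-filter⁻)
open import Data.List.Relation.Unary.Any as Any using (here; there; any?)
open import Data.List.Relation.Unary.All as All using (All; []; _∷_)
import Data.List.Relation.Unary.All.Properties as AllP
open import Data.List.Relation.Unary.AllPairs using (AllPairs; []; _∷_)
open import Data.List.Relation.Unary.Unique.Propositional using (Unique)
import Data.List.Relation.Unary.Unique.Propositional.Properties as Unique
open import Data.Product.Base as Product using (Σ; ∃; _×_; _,_; proj₁; proj₂)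
open import Data.Sum.Base as Sum using (_⊎_; inj₁; inj₂)
open import Data.Unit.Base using (⊤; tt)
open import Function.Base using (_∘_)
open import Relation.Nullary.Decidable using (yes; no; ¬?)
open import Relation.Nullary.Negation using (¬_; contradiction)
open import Relation.Binary.PropositionalEquality hiding ([_])
open import Relation.Binary.Definitions using (tri<; tri≈; tri>)

module IntegerCongruences where

  open import Data.Integer.Base using (ℤ; +_; -_; _+_; _-_; _*_; _^_; 0ℤ; 1ℤ; ∣_∣; _⊖_)
  open import Data.Integer.Properties
    using ( +-inverseʳ; +-identityˡ; +-identityʳ; *-zeroʳ; abs-*; pos-*; neg-distribˡ-*; ^-*-assoc
          ; [+m]-[+n]≡m⊖n; ∣⊖∣-<; ∣m⊖n∣≡∣n⊖m∣)
  open import Data.Integer.Divisibility.Signed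
    using (_∣_; ∣ᵤ⇒∣; ∣⇒∣ᵤ; ∣m∣n⇒∣m+n; ∣m∣n⇒∣m-n; ∣n⇒∣m*n; ∣m⇒∣m*n; ∣m⇒∣-m)
  open import Data.Integer.Tactic.RingSolver using (solve-∀)
  import Data.Nat.Divisibility as ℕ
  import Data.Nat.Properties as ℕ

  ∣-resp : ∀ {p x y} → x ≡ y → + p ∣ x → + p ∣ y
  ∣-resp refl p∣x = p∣x

  ≡-mod⇒∣ : ∀ {p} a b → a ≡ b [mod p ] → + p ∣ a - b
  ≡-mod⇒∣ {p} a b = ∣ᵤ⇒∣ {+ p} {a - b}

  ≡-mod-refl : ∀ {p} a → a ≡ a [mod p ]
  ≡-mod-refl {p} a = subst (λ x → p ℕ.∣ ∣ x ∣) (sym (+-inverseʳ a)) (p ℕ.∣0)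

  ≡-mod-sym : ∀ {p} {a b : ℤ} → a ≡ b [mod p ] → b ≡ a [mod p ]
  ≡-mod-sym {p} {a} {b} a≡b = ∣⇒∣ᵤ (∣-resp {p} (neg-sub a b) (∣m⇒∣-m (≡-mod⇒∣ a b a≡b)))
    where
    neg-sub : ∀ a b → - (a - b) ≡ b - a
    neg-sub = solve-∀

  ≡-mod-*-cong : ∀ {p} {a b c d : ℤ} → a ≡ b [mod p ] → c ≡ d [mod p ] → (a * c) ≡ (b * d) [mod p ]
  ≡-mod-*-cong {p} {a} {b} {c} {d} a≡b c≡d =
    ∣⇒∣ᵤ (∣-resp {p} (expand a b c d)
      (∣m∣n⇒∣m+n (∣n⇒∣m*n a (≡-mod⇒∣ c d c≡d)) (∣m⇒∣m*n d (≡-mod⇒∣ a b a≡b))))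
    where
    expand : ∀ a b c d → a * (c - d) + (a - b) * d ≡ a * c - b * d
    expand = solve-∀

  ≡-mod-^-cong : ∀ {p} {a b : ℤ} n → a ≡ b [mod p ] → (a ^ n) ≡ (b ^ n) [mod p ]
  ≡-mod-^-cong {p} zero    a≡b = ≡-mod-refl {p} 1ℤ
  ≡-mod-^-cong {p} {a} {b} (suc n) a≡b = ≡-mod-*-cong {p} {a} {b} a≡b (≡-mod-^-cong n a≡b)

  ^-distribʳ-* : ∀ a b n → (a * b) ^ n ≡ a ^ n * b ^ n
  ^-distribʳ-* a b zero    = refl
  ^-distribʳ-* a b (suc n) = trans (cong ((a * b) *_) (^-distribʳ-* a b n)) (swap a b (a ^ n) (b ^ n))
    where
    swap : ∀ a b x y → a * b * (x * y) ≡ a * x * (b * y)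
    swap = solve-∀

  ^-≡-mod-* : ∀ {p a b} {u w : ℤ} n → ((+ a) ^ n) ≡ u [mod p ] → ((+ b) ^ n) ≡ w [mod p ]
            → ((+ (a ℕ.* b)) ^ n) ≡ (u * w) [mod p ]
  ^-≡-mod-* {p} {a} {b} {u} {w} n aⁿ≡u bⁿ≡w =
    subst (λ x → x ≡ (u * w) [mod p ]) (sym (trans (cong (_^ n) (pos-* a b)) (^-distribʳ-* (+ a) (+ b) n)))
      (≡-mod-*-cong {p} {(+ a) ^ n} {u} aⁿ≡u bⁿ≡w)

  Cong-scale : ∀ {p} h x e → Cong h p x → Cong (h ℕ.* e) p (x ℕ.* e)
  Cong-scale {p} h x e xʰ≡ =
    subst₂ (λ u v → u ≡ v [mod p ])
      (sym (scaled (+ x) (pos-* x e))) (sym (scaled (- + h) (trans (cong -_ (pos-* h e)) (neg-distribˡ-* (+ h) (+ e)))))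
      (≡-mod-*-cong {p} {(+ x) ^ n} {(- + h) ^ n} xⁿ≡ (≡-mod-refl {p} ((+ e) ^ n)))
    where
    n = h ℕ.* e
    xⁿ≡ : ((+ x) ^ n) ≡ ((- + h) ^ n) [mod p ]
    xⁿ≡ = subst₂ (λ u v → u ≡ v [mod p ]) (^-*-assoc (+ x) h e) (^-*-assoc (- + h) h e)
            (≡-mod-^-cong {p} {(+ x) ^ h} {(- + h) ^ h} e xʰ≡)
    scaled : ∀ {z} y → z ≡ y * + e → z ^ n ≡ y ^ n * (+ e) ^ n
    scaled y z≡ = trans (cong (_^ n) z≡) (^-distribʳ-* y (+ e) n)

  p∤∣m⊖n∣ : ∀ {p m n} → m ℕ.< n → n ℕ.< p → ¬ (p ℕ.∣ ∣ m ⊖ n ∣)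
  p∤∣m⊖n∣ {p} {m} {n} m<n n<p p∣ =
    ℕ.>⇒∤ {{ℕ.>-nonZero (ℕ.m<n⇒0<n∸m m<n)}} (ℕ.≤-<-trans (ℕ.m∸n≤m n m) n<p)
      (subst (p ℕ.∣_) (∣⊖∣-< m<n) p∣)

  <-incongruent : ∀ {p x y} → x ℕ.< p → y ℕ.< p → x ≢ y → ¬ ((+ x) ≡ (+ y) [mod p ])
  <-incongruent {p} {x} {y} x<p y<p x≢y x≡y
    with ℕ.<-cmp x y | subst (λ z → p ℕ.∣ ∣ z ∣) ([+m]-[+n]≡m⊖n x y) x≡y
  ... | tri< x<y _ _  | p∣ = p∤∣m⊖n∣ x<y y<p p∣
  ... | tri≈ _ x≡y′ _ | _  = x≢y x≡y′
  ... | tri> _ _ y<x  | p∣ = p∤∣m⊖n∣ y<x x<p (subst (p ℕ.∣_) (∣m⊖n∣≡∣n⊖m∣ x y) p∣)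

  euclidsLemmaℤ : ∀ {p} → Prime p → ∀ a b → + p ∣ a * b → (+ p ∣ a) ⊎ (+ p ∣ b)
  euclidsLemmaℤ {p} pr a b p∣ab with euclidsLemma ∣ a ∣ ∣ b ∣ pr (subst (p ℕ.∣_) (abs-* a b) (∣⇒∣ᵤ p∣ab))
  ... | inj₁ p∣a = inj₁ (∣ᵤ⇒∣ p∣a)
  ... | inj₂ p∣b = inj₂ (∣ᵤ⇒∣ p∣b)

  p∤1 : ∀ {p} → Prime p → ¬ (+ p ∣ 1ℤ)
  p∤1 {p} pr p∣1 = ℕ.>⇒∤ (ℕ.nonTrivial⇒n>1 p {{prime⇒nonTrivial pr}}) (∣⇒∣ᵤ p∣1)

  -- Polynomial functions in Horner form: `Poly n f` says that f has degree
  -- below n, `Monic n f` that f is monic of degree n.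
  Poly : ℕ → (ℤ → ℤ) → Set
  Poly zero    f = ∀ y → f y ≡ 0ℤ
  Poly (suc n) f = Σ ℤ λ c → Σ (ℤ → ℤ) λ g → Poly n g × (∀ y → f y ≡ c + y * g y)

  Monic : ℕ → (ℤ → ℤ) → Set
  Monic zero    f = ∀ y → f y ≡ 1ℤ
  Monic (suc n) f = Σ ℤ λ c → Σ (ℤ → ℤ) λ g → Monic n g × (∀ y → f y ≡ c + y * g y)

  monic⇒poly : ∀ {n f} → Monic n f → Poly (suc n) f
  monic⇒poly {zero}  f≡1 = 1ℤ , (λ _ → 0ℤ) , (λ _ → refl) , λ y → trans (f≡1 y) (sym (constant y))
    where
    constant : ∀ y → 1ℤ + y * 0ℤ ≡ 1ℤ
    constant = solve-∀
  monic⇒poly {suc n} (c , g , g-monic , f≡) = c , g , monic⇒poly g-monic , f≡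

  poly-scale : ∀ {n f} r → Poly n f → Poly n (λ y → r * f y)
  poly-scale {zero}  r f≡0 y = trans (cong (r *_) (f≡0 y)) (*-zeroʳ r)
  poly-scale {suc n} r (c , g , g-poly , f≡) =
    r * c , (λ y → r * g y) , poly-scale r g-poly , λ y → trans (cong (r *_) (f≡ y)) (distrib r c y (g y))
    where
    distrib : ∀ r c y g → r * (c + y * g) ≡ r * c + y * (r * g)
    distrib = solve-∀

  monic-+-poly : ∀ {n f g} → Monic n f → Poly n g → Monic n (λ y → f y + g y)
  monic-+-poly {zero}  f≡1 g≡0 y rewrite f≡1 y | g≡0 y = refl
  monic-+-poly {suc n} (c , f′ , f′-monic , f≡) (d , g′ , g′-poly , g≡) =
    c + d , (λ y → f′ y + g′ y) , monic-+-poly f′-monic g′-poly ,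
    λ y → trans (cong₂ _+_ (f≡ y) (g≡ y)) (regroup c d y (f′ y) (g′ y))
    where
    regroup : ∀ c d y f g → (c + y * f) + (d + y * g) ≡ (c + d) + y * (f + g)
    regroup = solve-∀

  ^-monic : ∀ n → Monic n (_^ n)
  ^-monic zero    y = refl
  ^-monic (suc n) = 0ℤ , (_^ n) , ^-monic n , λ y → sym (+-identityˡ _)

  monic-factor : ∀ {n f} → Monic (suc n) f → ∀ r →
                 Σ (ℤ → ℤ) λ h → Monic n h × (∀ y → f y - f r ≡ (y - r) * h y)
  monic-factor {zero} {f} (c , g , g≡1 , f≡) r = (λ _ → 1ℤ) , (λ _ → refl) , λ y → begin
    f y - f r                     ≡⟨ cong₂ _-_ (f≡ y) (f≡ r) ⟩
    (c + y * g y) - (c + r * g r) ≡⟨ cong₂ (λ u v → (c + y * u) - (c + r * v)) (g≡1 y) (g≡1 r) ⟩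
    (c + y * 1ℤ) - (c + r * 1ℤ)   ≡⟨ linear c y r ⟩
    (y - r) * 1ℤ                  ∎
    where
    open ≡-Reasoning
    linear : ∀ c y r → (c + y * 1ℤ) - (c + r * 1ℤ) ≡ (y - r) * 1ℤ
    linear = solve-∀
  monic-factor {suc n} {f} (c , g , g-monic , f≡) r with monic-factor g-monic r
  ... | h , h-monic , g-factor =
    (λ y → g y + r * h y) , monic-+-poly g-monic (poly-scale r (monic⇒poly h-monic)) , λ y → begin
      f y - f r                           ≡⟨ cong₂ _-_ (f≡ y) (f≡ r) ⟩
      (c + y * g y) - (c + r * g r)       ≡⟨ split c y r (g y) (g r) ⟩
      (y - r) * g y + r * (g y - g r)     ≡⟨ cong (λ u → (y - r) * g y + r * u) (g-factor y) ⟩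
      (y - r) * g y + r * ((y - r) * h y) ≡⟨ factor y r (g y) (h y) ⟩
      (y - r) * (g y + r * h y)           ∎
    where
    open ≡-Reasoning
    split : ∀ c y r gy gr → (c + y * gy) - (c + r * gr) ≡ (y - r) * gy + r * (gy - gr)
    split = solve-∀
    factor : ∀ y r gy hy → (y - r) * gy + r * ((y - r) * hy) ≡ (y - r) * (gy + r * hy)
    factor = solve-∀

  poly-zero : ∀ n → Poly n (λ _ → 0ℤ)
  poly-zero zero    _ = refl
  poly-zero (suc n)   = 0ℤ , (λ _ → 0ℤ) , poly-zero n , λ y → sym (trans (+-identityˡ _) (*-zeroʳ y))

  poly-const : ∀ n c → Poly (suc n) (λ _ → c)
  poly-const n c =
    c , (λ _ → 0ℤ) , poly-zero n , λ y → sym (trans (cong (λ u → c + u) (*-zeroʳ y)) (+-identityʳ c))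

  Incongruent : ℕ → List ℤ → Set
  Incongruent p = AllPairs (λ y z → ¬ (y ≡ z [mod p ]))

  quotient-roots : ∀ {p} → Prime p → ∀ (f h : ℤ → ℤ) r → (∀ y → f y - f r ≡ (y - r) * h y) → + p ∣ f r
                 → ∀ ys → All (λ y → + p ∣ f y) ys → All (λ y → ¬ (r ≡ y [mod p ])) ys
                 → All (λ y → + p ∣ h y) ys
  quotient-roots pr f h r f-factor p∣fr []       []             []          = []
  quotient-roots {p} pr f h r f-factor p∣fr (y ∷ ys) (p∣fy ∷ p∣fys) (r≢y ∷ r≢ys)
    with euclidsLemmaℤ pr (y - r) (h y) (∣-resp {p} (f-factor y) (∣m∣n⇒∣m-n p∣fy p∣fr))
  ... | inj₁ p∣y-r = contradiction (≡-mod-sym {p} {y} {r} (∣⇒∣ᵤ p∣y-r)) r≢y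
  ... | inj₂ p∣hy  = p∣hy ∷ quotient-roots pr f h r f-factor p∣fr ys p∣fys r≢ys

  monic-roots≤degree : ∀ {p} → Prime p → ∀ n f → Monic n f → ∀ ys → All (λ y → + p ∣ f y) ys
                     → Incongruent p ys → length ys ℕ.≤ n
  monic-roots≤degree pr n       f f-monic []       _                 _ = z≤n
  monic-roots≤degree pr zero    f f≡1     (y ∷ _)  (p∣fy ∷ _)        _ =
    contradiction (∣-resp (f≡1 y) p∣fy) (p∤1 pr)
  monic-roots≤degree pr (suc n) f f-monic (r ∷ ys) (p∣fr ∷ p∣fys) (r≢ys ∷ incong)
    with monic-factor f-monic r
  ... | h , h-monic , f-factor =
    s≤s (monic-roots≤degree pr n h h-monic ys (quotient-roots pr f h r f-factor p∣fr ys p∣fys r≢ys) incong)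

  unique∧<⇒incongruent : ∀ {p} {ys : List ℕ} → Unique ys → All (ℕ._< p) ys → Incongruent p (map +_ ys)
  unique∧<⇒incongruent []              []            = []
  unique∧<⇒incongruent (y∉ys ∷ unique) (y<p ∷ ys<p) =
    AllP.map⁺ (All.zipWith (λ (y≢z , z<p) → <-incongruent y<p z<p y≢z) (y∉ys , ys<p))
    ∷ unique∧<⇒incongruent unique ys<p

  power-fibre≤degree : ∀ {p} → Prime p → ∀ {n} → 0 ℕ.< n → ∀ c (ys : List ℕ) → Unique ys → All (ℕ._< p) ys
                     → All (λ y → ((+ y) ^ n) ≡ c [mod p ]) ys → length ys ℕ.≤ n
  power-fibre≤degree pr {suc n} _ c ys unique ys<p fibre = subst (ℕ._≤ suc n) (length-map +_ ys)
    (monic-roots≤degree pr (suc n) (λ y → y ^ suc n - c) (monic-+-poly (^-monic (suc n)) (poly-const n (- c)))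
      (map +_ ys) (AllP.map⁺ (All.map (λ {y} → ≡-mod⇒∣ ((+ y) ^ suc n) c) fibre))
      (unique∧<⇒incongruent unique ys<p))

open IntegerCongruences
import Data.Integer.Base as ℤ
import Data.Integer.Properties as ℤ
open import Data.Nat.Base using (_+_; _*_; _∸_; _^_; _≤_; _<_; pred; NonZero; >-nonZero; nonTrivial⇒n>1)
open import Data.Nat.Properties
open import Data.Nat.Tactic.RingSolver using (solve-∀)
open import Data.Nat.Divisibility
  using (_∣_; divides; _∣?_; ∣⇒≤; >⇒∤; _∣0; 1∣_; ∣-refl; ∣-trans; ∣m⇒∣m*n; m∣m*n; *-pres-∣)
open import Data.Nat.DivMod using (_/_; m*n/n≡m)
open import Data.Nat.GCD using (gcd; c*gcd[m,n]≡gcd[cm,cn])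
open import Data.Nat.Induction using (<-rec)
open import Data.Nat.ListAction using (sum; product)
open import Data.Nat.Primality.Factorisation using (factorise)

-- Lists and injections

∈-range1⁻ : ∀ {x n} → x ∈ range1 n → 1 ≤ x × x ≤ n
∈-range1⁻ x∈ with ∈-map⁻ suc x∈
... | _ , i∈ , refl = s≤s z≤n , ∈-upTo⁻ i∈

∈-range1⁺ : ∀ {x n} → 1 ≤ x → x ≤ n → x ∈ range1 n
∈-range1⁺ {suc x} _ x≤n = ∈-map⁺ suc (∈-upTo⁺ x≤n)

range1-unique : ∀ n → Unique (range1 n)
range1-unique n = Unique.map⁺ suc-injective (Unique.upTo⁺ n)

∈-++-∷⁻ : ∀ {A : Set} {x y : A} us {vs} → y ∈ us ++ x ∷ vs → y ≢ x → y ∈ us ++ vs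
∈-++-∷⁻ []       (here y≡x) y≢x = contradiction y≡x y≢x
∈-++-∷⁻ []       (there y∈) _   = y∈
∈-++-∷⁻ (u ∷ us) (here y≡u) _   = here y≡u
∈-++-∷⁻ (u ∷ us) (there y∈) y≢x = there (∈-++-∷⁻ us y∈ y≢x)

unique-⊆⇒length≤ : ∀ {A : Set} {xs ys : List A} → Unique xs → (∀ {x} → x ∈ xs → x ∈ ys) → length xs ≤ length ys
unique-⊆⇒length≤ {xs = []}     _                 _  = z≤n
unique-⊆⇒length≤ {xs = x ∷ xs} (x∉xs ∷ unique) xs⊆ys with ∈-∃++ (xs⊆ys (here refl))
... | us , vs , refl = begin
  suc (length xs)         ≤⟨ s≤s (unique-⊆⇒length≤ unique xs⊆us++vs) ⟩
  suc (length (us ++ vs)) ≡⟨ cong suc (length-++ us) ⟩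
  suc (length us + length vs) ≡⟨ +-suc (length us) (length vs) ⟨
  length us + length (x ∷ vs) ≡⟨ length-++ us ⟨
  length (us ++ x ∷ vs)   ∎
  where
  open ≤-Reasoning
  xs⊆us++vs : ∀ {y} → y ∈ xs → y ∈ us ++ vs
  xs⊆us++vs y∈xs = ∈-++-∷⁻ us (xs⊆ys (there y∈xs)) (λ y≡x → All.lookup x∉xs y∈xs (sym y≡x))

InjectiveOn : ∀ {A B : Set} → (A → B) → List A → Set
InjectiveOn f xs = ∀ {a b} → a ∈ xs → b ∈ xs → f a ≡ f b → a ≡ b

map⁺-injectiveOn : ∀ {A B : Set} {f : A → B} {xs} → Unique xs → InjectiveOn f xs → Unique (map f xs)
map⁺-injectiveOn {xs = []}     []              _   = []
map⁺-injectiveOn {xs = x ∷ xs} (x∉xs ∷ unique) inj =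
  AllP.map⁺ (All.tabulate (λ y∈xs fx≡fy → All.lookup x∉xs y∈xs (inj (here refl) (there y∈xs) fx≡fy)))
  ∷ map⁺-injectiveOn unique (λ a∈ b∈ → inj (there a∈) (there b∈))

injectiveOn⇒length≤ : ∀ {A B : Set} {f : A → B} {xs ys} → Unique xs → InjectiveOn f xs
                    → (∀ {a} → a ∈ xs → f a ∈ ys) → length xs ≤ length ys
injectiveOn⇒length≤ {f = f} {xs} unique inj maps-into =
  subst (_≤ _) (length-map f xs) (unique-⊆⇒length≤ (map⁺-injectiveOn unique inj) image⊆)
  where
  image⊆ : ∀ {y} → y ∈ map f xs → y ∈ _
  image⊆ y∈ with ∈-map⁻ f y∈
  ... | _ , a∈ , refl = maps-into a∈

1≤* : ∀ {a b} → 1 ≤ a → 1 ≤ b → 1 ≤ a * b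
1≤* 1≤a 1≤b = *-mono-≤ 1≤a 1≤b

1≤^ : ∀ {a} n → 1 ≤ a → 1 ≤ a ^ n
1≤^ {a} n 1≤a = subst (_≤ a ^ n) (^-zeroˡ n) (^-monoˡ-≤ n 1≤a)

prime>1 : ∀ {q} → Prime q → 1 < q
prime>1 {q} pr = nonTrivial⇒n>1 q {{prime⇒nonTrivial pr}}

prime∤1 : ∀ {q} → Prime q → ¬ q ∣ 1
prime∤1 pr = >⇒∤ (prime>1 pr)

∃-prime-divisor : ∀ {n} → 1 < n → ∃ λ q → Prime q × q ∣ n
∃-prime-divisor {suc n} 1<n with factorise (suc n)
... | record { factors = []     ; isFactorisation = n≡1 } = contradiction n≡1 (>⇒≢ 1<n)
... | record { factors = q ∷ qs ; isFactorisation = n≡q*qs ; factorsPrime = q-prime ∷ _ } =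
  q , q-prime , divides (product qs) (trans n≡q*qs (*-comm q (product qs)))

-- Valuations

ExactPower : ℕ → ℕ → ℕ → Set
ExactPower q e n = ∃ λ m → n ≡ q ^ e * m × ¬ q ∣ m

-- The fuel n suffices: each step divides n by q ≥ 2.
valuationWithin : ℕ → ℕ → ℕ → ℕ
valuationWithin zero    q n = 0
valuationWithin (suc f) q n with q ∣? n
... | yes (divides m _) = suc (valuationWithin f q m)
... | no  _             = 0

valuation : ℕ → ℕ → ℕ
valuation q n = valuationWithin n q n

valuationWithin-exact : ∀ {q n} f → 1 < q → 1 ≤ n → n ≤ f → ExactPower q (valuationWithin f q n) n
valuationWithin-exact zero    q>1 1≤n n≤0 = contradiction (≤-trans 1≤n n≤0) λ ()
valuationWithin-exact {q} {n} (suc f) q>1 1≤n n≤f with q ∣? n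
... | no  q∤n = n , sym (*-identityˡ n) , q∤n
... | yes (divides m n≡m*q) with valuationWithin-exact f q>1 1≤m m≤f
  where
  1≤m : 1 ≤ m
  1≤m = n≢0⇒n>0 λ { refl → contradiction n≡m*q (>⇒≢ 1≤n) }
  m≤f : m ≤ f
  m≤f = ≤-pred (≤-trans (subst (m <_) (sym n≡m*q) (m<m*n m q {{>-nonZero 1≤m}} q>1)) n≤f)
... | m′ , m≡ , q∤m′ = m′ , n≡ , q∤m′
  where
  n≡ : n ≡ q ^ suc (valuationWithin f q m) * m′
  n≡ = begin
    n                                       ≡⟨ n≡m*q ⟩
    m * q                                   ≡⟨ cong (_* q) m≡ ⟩
    q ^ valuationWithin f q m * m′ * q      ≡⟨ rotate (q ^ valuationWithin f q m) m′ q ⟩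
    q * q ^ valuationWithin f q m * m′      ∎
    where
    open ≡-Reasoning
    rotate : ∀ a b c → a * b * c ≡ c * a * b
    rotate = solve-∀

exactPower⇒>0 : ∀ {q e n} → 1 < q → ExactPower q e n → 0 < n
exactPower⇒>0 {q} {e} q>1 (zero  , n≡ , q∤0) = contradiction (q ∣0) q∤0
exactPower⇒>0 {q} {e} q>1 (suc m , n≡ , _)   =
  subst (0 <_) (sym n≡) (1≤* (1≤^ e (<⇒≤ q>1)) (s≤s z≤n))

q^e*m-unique : ∀ {q m m′} e e′ → 1 < q → q ^ e * m ≡ q ^ e′ * m′ → ¬ q ∣ m → ¬ q ∣ m′ → e ≡ e′
q^e*m-unique zero     zero     _   _  _   _    = refl
q^e*m-unique {q} {m} {m′} zero (suc e′) _ eq q∤m _ =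
  contradiction (subst (q ∣_) (trans (sym eq) (*-identityˡ m)) (∣m⇒∣m*n m′ (m∣m*n (q ^ e′)))) q∤m
q^e*m-unique {q} {m} {m′} (suc e) zero _ eq _ q∤m′ =
  contradiction (subst (q ∣_) (trans eq (*-identityˡ m′)) (∣m⇒∣m*n m (m∣m*n (q ^ e)))) q∤m′
q^e*m-unique {q} {m} {m′} (suc e) (suc e′) q>1 eq q∤m q∤m′ =
  cong suc (q^e*m-unique e e′ q>1 (*-cancelˡ-≡ _ _ q {{>-nonZero (<⇒≤ q>1)}} eq′) q∤m q∤m′)
  where
  eq′ : q * (q ^ e * m) ≡ q * (q ^ e′ * m′)
  eq′ = trans (sym (*-assoc q (q ^ e) m)) (trans eq (*-assoc q (q ^ e′) m′))

exactPower-unique : ∀ {q e e′ n} → 1 < q → ExactPower q e n → ExactPower q e′ n → e ≡ e′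
exactPower-unique {e = e} {e′} q>1 (m , n≡ , q∤m) (m′ , n≡′ , q∤m′) =
  q^e*m-unique e e′ q>1 (trans (sym n≡) n≡′) q∤m q∤m′

valuation-exact : ∀ {q n} → 1 < q → 1 ≤ n → ExactPower q (valuation q n) n
valuation-exact {n = n} q>1 1≤n = valuationWithin-exact n q>1 1≤n ≤-refl

valuation-unique : ∀ {q e n} → 1 < q → ExactPower q e n → valuation q n ≡ e
valuation-unique {q} {e} {n} q>1 qᵉ∥n =
  exactPower-unique {q} {valuation q n} {e} {n} q>1 (valuation-exact q>1 (exactPower⇒>0 {q} {e} {n} q>1 qᵉ∥n)) qᵉ∥n

valuation-1 : ∀ {q} → 1 < q → valuation q 1 ≡ 0
valuation-1 q>1 = valuation-unique q>1 (1 , refl , >⇒∤ q>1)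

valuation-∤ : ∀ {q n} → 1 < q → 1 ≤ n → ¬ q ∣ n → valuation q n ≡ 0
valuation-∤ {n = n} q>1 1≤n q∤n = valuation-unique q>1 (n , sym (*-identityˡ n) , q∤n)

valuation-∣ : ∀ {q n} → 1 < q → 1 ≤ n → q ∣ n → 1 ≤ valuation q n
valuation-∣ {q} {n} q>1 1≤n q∣n with valuation q n | valuation-exact {q} {n} q>1 1≤n
... | zero  | m , n≡ , q∤m = contradiction (subst (q ∣_) (trans n≡ (*-identityˡ m)) q∣n) q∤m
... | suc _ | _            = s≤s z≤n

valuation-* : ∀ {q a b} → Prime q → 1 ≤ a → 1 ≤ b → valuation q (a * b) ≡ valuation q a + valuation q b
valuation-* {q} {a} {b} pr 1≤a 1≤b
  with valuation-exact {q} {a} (prime>1 pr) 1≤a | valuation-exact {q} {b} (prime>1 pr) 1≤b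
... | m , a≡ , q∤m | m′ , b≡ , q∤m′ = valuation-unique (prime>1 pr) (m * m′ , ab≡ , q∤mm′)
  where
  va = valuation q a
  vb = valuation q b
  ab≡ : a * b ≡ q ^ (va + vb) * (m * m′)
  ab≡ = begin
    a * b                          ≡⟨ cong₂ _*_ a≡ b≡ ⟩
    q ^ va * m * (q ^ vb * m′)     ≡⟨ interchange (q ^ va) m (q ^ vb) m′ ⟩
    q ^ va * q ^ vb * (m * m′)     ≡⟨ cong (_* (m * m′)) (^-distribˡ-+-* q va vb) ⟨
    q ^ (va + vb) * (m * m′)       ∎
    where
    open ≡-Reasoning
    interchange : ∀ x m y n → x * m * (y * n) ≡ x * y * (m * n)
    interchange = solve-∀
  q∤mm′ : ¬ q ∣ m * m′
  q∤mm′ q∣mm′ with euclidsLemma m m′ pr q∣mm′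
  ... | inj₁ q∣m  = q∤m q∣m
  ... | inj₂ q∣m′ = q∤m′ q∣m′

prime∣prime^⇒≡ : ∀ {q r} v → Prime q → Prime r → q ∣ r ^ v → q ≡ r
prime∣prime^⇒≡ zero    q-prime _       q∣1 = contradiction q∣1 (prime∤1 q-prime)
prime∣prime^⇒≡ {q} {r} (suc v) q-prime r-prime q∣rʳ with euclidsLemma r (r ^ v) q-prime q∣rʳ
... | inj₂ q∣rᵛ = prime∣prime^⇒≡ v q-prime r-prime q∣rᵛ
... | inj₁ q∣r with prime⇒irreducible r-prime q∣r
...   | inj₁ q≡1 = contradiction q≡1 (>⇒≢ (prime>1 q-prime))
...   | inj₂ q≡r = q≡r

valuation-prime^ : ∀ {q r} v → Prime q → Prime r → q ≢ r → valuation q (r ^ v) ≡ 0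
valuation-prime^ v q-prime r-prime q≢r =
  valuation-∤ (prime>1 q-prime) (1≤^ v (<⇒≤ (prime>1 r-prime))) (q≢r ∘ prime∣prime^⇒≡ v q-prime r-prime)

ValuationsDiffer : ℕ → ℕ → Set
ValuationsDiffer a b = ∃ λ q → Prime q × (q ∣ a ⊎ q ∣ b) × valuation q a ≢ valuation q b

valuationsDiffer-sym : ∀ {a b} → ValuationsDiffer a b → ValuationsDiffer b a
valuationsDiffer-sym (q , q-prime , q∣a⊎b , νa≢νb) = q , q-prime , Sum.swap q∣a⊎b , νa≢νb ∘ sym

∣∧∤⇒valuationsDiffer : ∀ {q a b} → Prime q → 1 ≤ a → 1 ≤ b → q ∣ a → ¬ q ∣ b → ValuationsDiffer a b
∣∧∤⇒valuationsDiffer q-prime 1≤a 1≤b q∣a q∤b =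
  _ , q-prime , inj₁ q∣a , λ νa≡νb → >⇒≢ (valuation-∣ (prime>1 q-prime) 1≤a q∣a)
                                         (trans νa≡νb (valuation-∤ (prime>1 q-prime) 1≤b q∤b))

valuationsDiffer-* : ∀ {q a b} → Prime q → 1 ≤ a → 1 ≤ b → ValuationsDiffer a b → ValuationsDiffer (a * q) (b * q)
valuationsDiffer-* {q} {a} {b} q-prime 1≤a 1≤b (r , r-prime , r∣a⊎b , νa≢νb) =
  r , r-prime , Sum.map (∣m⇒∣m*n q) (∣m⇒∣m*n q) r∣a⊎b , λ νaq≡νbq → νa≢νb (+-cancelʳ-≡ _ _ _ (begin
    valuation r a + valuation r q ≡⟨ valuation-* r-prime 1≤a 1≤q ⟨
    valuation r (a * q)           ≡⟨ νaq≡νbq ⟩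
    valuation r (b * q)           ≡⟨ valuation-* r-prime 1≤b 1≤q ⟩
    valuation r b + valuation r q ∎))
  where
  open ≡-Reasoning
  1≤q = <⇒≤ (prime>1 q-prime)

≢⇒valuationsDiffer : ∀ a {b} → 1 ≤ a → 1 ≤ b → a ≢ b → ValuationsDiffer a b
≢⇒valuationsDiffer = <-rec (λ a → ∀ {b} → 1 ≤ a → 1 ≤ b → a ≢ b → ValuationsDiffer a b) step
  where
  step : ∀ a → (∀ {a′} → a′ < a → ∀ {b} → 1 ≤ a′ → 1 ≤ b → a′ ≢ b → ValuationsDiffer a′ b)
       → ∀ {b} → 1 ≤ a → 1 ≤ b → a ≢ b → ValuationsDiffer a b
  step 1 _ {b} 1≤1 1≤b 1≢b with ∃-prime-divisor {b} (≤∧≢⇒< 1≤b 1≢b)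
  ... | q , q-prime , q∣b = valuationsDiffer-sym (∣∧∤⇒valuationsDiffer q-prime 1≤b 1≤1 q∣b (prime∤1 q-prime))
  step a@(suc (suc _)) rec {b} 1≤a 1≤b a≢b with ∃-prime-divisor {a} (s≤s (s≤s z≤n))
  ... | q , q-prime , q∣a with q ∣? b
  ...   | no q∤b = ∣∧∤⇒valuationsDiffer q-prime 1≤a 1≤b q∣a q∤b
  ...   | yes (divides b′ b≡b′q) with q∣a
  ...     | divides a′ a≡a′q = subst₂ ValuationsDiffer (sym a≡a′q) (sym b≡b′q)
              (valuationsDiffer-* q-prime 1≤a′ 1≤b′ (rec a′<a 1≤a′ 1≤b′ a′≢b′))
    where
    cofactor-pos : ∀ {n c} → 1 ≤ n → n ≡ c * q → 1 ≤ c
    cofactor-pos {c = zero}  1≤n n≡0 = contradiction n≡0 (>⇒≢ 1≤n)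
    cofactor-pos {c = suc c} _   _   = s≤s z≤n
    1≤a′ = cofactor-pos 1≤a a≡a′q
    1≤b′ = cofactor-pos 1≤b b≡b′q
    a′<a : a′ < a
    a′<a = subst (a′ <_) (sym a≡a′q) (m<m*n a′ q {{>-nonZero 1≤a′}} (prime>1 q-prime))
    a′≢b′ : a′ ≢ b′
    a′≢b′ a′≡b′ = a≢b (trans a≡a′q (trans (cong (_* q) a′≡b′) (sym b≡b′q)))

-- Prime counting and the j-th prime

range1-suc : ∀ n → range1 (suc n) ≡ range1 n ++ [ suc n ]
range1-suc n = trans (cong (map suc) (sym (upTo-∷ʳ n))) (map-++ suc (upTo n) [ n ])

primeCount-suc : ∀ n → primeCount (suc n) ≡ primeCount n + length (filter prime? [ suc n ])
primeCount-suc n = begin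
  length (filter prime? (range1 (suc n)))                       ≡⟨ cong (length ∘ filter prime?) (range1-suc n) ⟩
  length (filter prime? (range1 n ++ [ suc n ]))                ≡⟨ cong length (filter-++ prime? (range1 n) [ suc n ]) ⟩
  length (filter prime? (range1 n) ++ filter prime? [ suc n ])  ≡⟨ length-++ (filter prime? (range1 n)) ⟩
  primeCount n + length (filter prime? [ suc n ])               ∎
  where open ≡-Reasoning

primeCount-suc-prime : ∀ {n} → Prime (suc n) → primeCount (suc n) ≡ suc (primeCount n)
primeCount-suc-prime {n} pr = trans (primeCount-suc n)
  (trans (cong (λ l → primeCount n + length l) (filter-accept prime? {xs = []} pr)) (+-comm (primeCount n) 1))

primeCount-suc-nonprime : ∀ {n} → ¬ Prime (suc n) → primeCount (suc n) ≡ primeCount n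
primeCount-suc-nonprime {n} ¬pr = trans (primeCount-suc n)
  (trans (cong (λ l → primeCount n + length l) (filter-reject prime? {xs = []} ¬pr)) (+-identityʳ (primeCount n)))

primeCount-≤-suc : ∀ n → primeCount n ≤ primeCount (suc n)
primeCount-≤-suc n with prime? (suc n)
... | yes pr  = ≤-trans (n≤1+n _) (≤-reflexive (sym (primeCount-suc-prime pr)))
... | no  ¬pr = ≤-reflexive (sym (primeCount-suc-nonprime ¬pr))

primeCount-mono : ∀ {m n} → m ≤ n → primeCount m ≤ primeCount n
primeCount-mono {m} {n} m≤n with m≤n⇒∃[o]m+o≡n m≤n
... | o , refl = go o
  where
  go : ∀ o → primeCount m ≤ primeCount (m + o)
  go zero    = ≤-reflexive (cong primeCount (sym (+-identityʳ m)))
  go (suc o) = ≤-trans (go o) (≤-trans (primeCount-≤-suc (m + o)) (≤-reflexive (cong primeCount (sym (+-suc m o)))))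

<⇒primeCount< : ∀ {m q} → m < q → Prime q → primeCount m < primeCount q
<⇒primeCount< {m} {suc q} (s≤s m≤q) pr =
  ≤-trans (s≤s (primeCount-mono m≤q)) (≤-reflexive (sym (primeCount-suc-prime pr)))

-- The j-th prime, provided it is at most n.
nthPrime≤ : ℕ → ℕ → ℕ
nthPrime≤ zero    j = 0
nthPrime≤ (suc n) j with j ≤? primeCount n
... | yes _ = nthPrime≤ n j
... | no  _ = suc n

nthPrime≤-prime : ∀ n {j} → 1 ≤ j → j ≤ primeCount n → Prime (nthPrime≤ n j) × primeCount (nthPrime≤ n j) ≡ j
nthPrime≤-prime zero    1≤j j≤0 = contradiction (≤-trans 1≤j j≤0) λ ()
nthPrime≤-prime (suc n) {j} 1≤j j≤π with j ≤? primeCount n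
... | yes j≤πn = nthPrime≤-prime n 1≤j j≤πn
... | no  j≰πn with prime? (suc n)
...   | yes pr  = pr , ≤-antisym (≤-trans (≤-reflexive (primeCount-suc-prime pr)) (≰⇒> j≰πn)) j≤π
...   | no  ¬pr = contradiction (subst (j ≤_) (primeCount-suc-nonprime ¬pr) j≤π) j≰πn

nthPrime≤-least : ∀ n {j m} → m ≤ n → j ≤ primeCount m → nthPrime≤ n j ≤ m
nthPrime≤-least zero    {m = m} m≤0 _ = z≤n
nthPrime≤-least (suc n) {j} {m} m≤1+n j≤πm with j ≤? primeCount n | m ≟ suc n
... | yes j≤πn | yes refl = ≤-trans (nthPrime≤-least n ≤-refl j≤πn) (n≤1+n n)
... | yes _    | no  m≢  = nthPrime≤-least n (≤-pred (≤∧≢⇒< m≤1+n m≢)) j≤πm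
... | no  _    | yes refl = ≤-refl
... | no  j≰πn | no  m≢  = contradiction (≤-trans j≤πm (primeCount-mono (≤-pred (≤∧≢⇒< m≤1+n m≢)))) j≰πn

-- Branching primes

record Branch : Set where
  constructor branch
  field
    prime exponent witness : ℕ
open Branch

agreeing : ℕ → ℕ → List ℕ → List ℕ
agreeing q v = filter (λ x → valuation q x ≟ v)

∈-agreeing⁻ : ∀ {q v S x} → x ∈ agreeing q v S → x ∈ S × valuation q x ≡ v
∈-agreeing⁻ {q} {v} {S} = ∈-filter⁻ (λ x → valuation q x ≟ v) {xs = S}

branchAt : ℕ → ℕ → List ℕ → List Branch → List Branch
branchAt q v S bs with any? (λ x → ¬? (valuation q x ≟ v)) S
... | yes ∃x = branch q v (proj₁ (find ∃x)) ∷ bs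
... | no  _  = bs

-- Scans the primes m, …, m + f - 1, keeping the candidates in S that agree with a so far.
branches : ℕ → List ℕ → ℕ → ℕ → List Branch
branches a S m zero    = []
branches a S m (suc f) with prime? m
... | yes _ = branchAt m (valuation m a) S (branches a (agreeing m (valuation m a) S) (suc m) f)
... | no  _ = branches a S (suc m) f

branchAt-witness∈ : ∀ q v S bs → All (λ b → witness b ∈ S) bs → All (λ b → witness b ∈ S) (branchAt q v S bs)
branchAt-witness∈ q v S bs ws∈S with any? (λ x → ¬? (valuation q x ≟ v)) S
... | yes ∃x = proj₁ (proj₂ (find ∃x)) ∷ ws∈S
... | no  _  = ws∈S

branches-witness∈ : ∀ a S m f → All (λ b → witness b ∈ S) (branches a S m f)
branches-witness∈ a S m zero    = []
branches-witness∈ a S m (suc f) with prime? m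
... | yes _ = branchAt-witness∈ m _ S _
                (All.map (proj₁ ∘ ∈-agreeing⁻ {S = S}) (branches-witness∈ a (agreeing m (valuation m a) S) (suc m) f))
... | no  _ = branches-witness∈ a S (suc m) f

Ascending : ℕ → List Branch → Set
Ascending m []       = ⊤
Ascending m (b ∷ bs) = m ≤ prime b × Prime (prime b) × Ascending (suc (prime b)) bs

ascending-weaken : ∀ {m m′} bs → m ≤ m′ → Ascending m′ bs → Ascending m bs
ascending-weaken []       _     _                  = tt
ascending-weaken (b ∷ bs) m≤m′ (m′≤q , q-prime , asc) = ≤-trans m≤m′ m′≤q , q-prime , asc

branchAt-ascending : ∀ {q} v S bs → Prime q → Ascending (suc q) bs → Ascending q (branchAt q v S bs)
branchAt-ascending {q} v S bs q-prime asc with any? (λ x → ¬? (valuation q x ≟ v)) S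
... | yes _ = ≤-refl , q-prime , asc
... | no  _ = ascending-weaken bs (n≤1+n q) asc

branches-ascending : ∀ a S m f → Ascending m (branches a S m f)
branches-ascending a S m zero    = tt
branches-ascending a S m (suc f) with prime? m
... | yes m-prime = branchAt-ascending _ S _ m-prime (branches-ascending a _ (suc m) f)
... | no  _       = ascending-weaken (branches a S (suc m) f) (n≤1+n m) (branches-ascending a S (suc m) f)

Separated : ℕ → List Branch → Set
Separated a []                  = ⊤
Separated a (branch q v c ∷ bs) =
  v ≡ valuation q a × valuation q c ≢ v × All (λ b → valuation q (witness b) ≡ v) bs × Separated a bs

branchAt-separated : ∀ a q S bs → Prime q → All (λ b → valuation q (witness b) ≡ valuation q a) bs
                   → Separated a bs → Separated a (branchAt q (valuation q a) S bs)
branchAt-separated a q S bs q-prime agree sep with any? (λ x → ¬? (valuation q x ≟ valuation q a)) S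
... | yes ∃x = refl , proj₂ (proj₂ (find ∃x)) , agree , sep
... | no  _  = sep

branches-separated : ∀ a S m f → Separated a (branches a S m f)
branches-separated a S m zero    = tt
branches-separated a S m (suc f) with prime? m
... | yes m-prime = branchAt-separated a m S _ m-prime
      (All.map (proj₂ ∘ ∈-agreeing⁻ {S = S}) (branches-witness∈ a (agreeing m (valuation m a) S) (suc m) f))
      (branches-separated a _ (suc m) f)
... | no  _ = branches-separated a S (suc m) f

data Diverge : List Branch → List Branch → Set where
  now   : ∀ {q v v′ c c′ bs bs′} → v ≢ v′ → Diverge (branch q v c ∷ bs) (branch q v′ c′ ∷ bs′)
  later : ∀ {q v c c′ bs bs′} → Diverge bs bs′ → Diverge (branch q v c ∷ bs) (branch q v c′ ∷ bs′)

branchAt-diverge : ∀ q v S {bs bs′} → Diverge bs bs′ → Diverge (branchAt q v S bs) (branchAt q v S bs′)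
branchAt-diverge q v S bs⋔bs′ with any? (λ x → ¬? (valuation q x ≟ v)) S
... | yes _ = later bs⋔bs′
... | no  _ = bs⋔bs′

branchAt-branches : ∀ q v S bs {c} → c ∈ S → valuation q c ≢ v → ∃ λ w → branchAt q v S bs ≡ branch q v w ∷ bs
branchAt-branches q v S bs c∈S νc≢v with any? (λ x → ¬? (valuation q x ≟ v)) S
... | yes ∃x = proj₁ (find ∃x) , refl
... | no  ∄x = contradiction (Any.map (λ { refl → νc≢v }) c∈S) ∄x

branches-diverge : ∀ {a b q} S m f → a ∈ S → b ∈ S → Prime q → m ≤ q → q < m + f
                 → valuation q a ≢ valuation q b → Diverge (branches a S m f) (branches b S m f)
branches-diverge S m zero _ _ _ m≤q q<m+0 _ =
  contradiction (≤-trans q<m+0 (≤-reflexive (+-identityʳ m))) (≤⇒≯ m≤q)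
branches-diverge {a} {b} {q} S m (suc f) a∈S b∈S q-prime m≤q q<m+1+f νa≢νb with prime? m
... | no m-nonprime =
  branches-diverge S (suc m) f a∈S b∈S q-prime (≤∧≢⇒< m≤q λ { refl → m-nonprime q-prime }) q<1+m+f νa≢νb
  where q<1+m+f = subst (q <_) (+-suc m f) q<m+1+f
... | yes _ with valuation m a ≟ valuation m b
...   | yes νₘa≡νₘb rewrite νₘa≡νₘb =
  branchAt-diverge m (valuation m b) S
    (branches-diverge _ (suc m) f (∈-filter⁺ _ a∈S νₘa≡νₘb) (∈-filter⁺ _ b∈S refl) q-prime
      (≤∧≢⇒< m≤q λ { refl → νa≢νb νₘa≡νₘb }) (subst (q <_) (+-suc m f) q<m+1+f) νa≢νb)
...   | no νₘa≢νₘb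
  with branchAt-branches m (valuation m a) S (branches a (agreeing m (valuation m a) S) (suc m) f) b∈S (νₘa≢νₘb ∘ sym)
     | branchAt-branches m (valuation m b) S (branches b (agreeing m (valuation m b) S) (suc m) f) a∈S νₘa≢νₘb
... | _ , a-branches | _ , b-branches rewrite a-branches | b-branches = now νₘa≢νₘb

Rank : ℕ → List Branch → Set
Rank j []       = ⊤
Rank j (b ∷ bs) = suc j ≤ primeCount (prime b) × Rank (suc j) bs

rank-weaken : ∀ {j j′} bs → j ≤ j′ → Rank j′ bs → Rank j bs
rank-weaken []       _    _              = tt
rank-weaken (b ∷ bs) j≤j′ (j′<πq , rank) = ≤-trans (s≤s j≤j′) j′<πq , rank-weaken bs (s≤s j≤j′) rank

ascending⇒rank : ∀ {m} bs → Ascending (suc m) bs → Rank (primeCount m) bs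
ascending⇒rank []       _                       = tt
ascending⇒rank (b ∷ bs) (m<q , q-prime , asc) =
  <⇒primeCount< m<q q-prime , rank-weaken bs (<⇒primeCount< m<q q-prime) (ascending⇒rank bs asc)

-- Replaces the i-th branching prime by the (j + i)-th prime, which Rank j keeps below it.
encode : ℕ → List Branch → ℕ
encode j []       = 1
encode j (b ∷ bs) = nthPrime≤ (prime b) (suc j) ^ exponent b * encode (suc j) bs

primePowers : List Branch → ℕ
primePowers []       = 1
primePowers (b ∷ bs) = prime b ^ exponent b * primePowers bs

encode-positive : ∀ j bs → Rank j bs → 1 ≤ encode j bs
encode-positive j []       _              = s≤s z≤n
encode-positive j (b ∷ bs) (j<πq , rank) =
  1≤* (1≤^ (exponent b) (<⇒≤ (prime>1 (proj₁ (nthPrime≤-prime (prime b) (s≤s z≤n) j<πq)))))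
      (encode-positive (suc j) bs rank)

encode≤primePowers : ∀ j bs → Rank j bs → encode j bs ≤ primePowers bs
encode≤primePowers j []       _              = ≤-refl
encode≤primePowers j (b ∷ bs) (j<πq , rank) =
  *-mono-≤ (^-monoˡ-≤ (exponent b) (nthPrime≤-least (prime b) ≤-refl j<πq)) (encode≤primePowers (suc j) bs rank)

encode-primeDivisor : ∀ j bs {r} → Rank j bs → Prime r → r ∣ encode j bs → suc j ≤ primeCount r × primeCount r ≤ j + length bs
encode-primeDivisor j []       _              r-prime r∣1 = contradiction r∣1 (prime∤1 r-prime)
encode-primeDivisor j (b ∷ bs) {r} (j<πq , rank) r-prime r∣ with euclidsLemma _ (encode (suc j) bs) r-prime r∣
... | inj₁ r∣Pᵛ = ≤-reflexive (sym πr≡) ,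
    ≤-trans (≤-reflexive πr≡) (subst (suc j ≤_) (sym (+-suc j (length bs))) (s≤s (m≤m+n j (length bs))))
  where
  πr≡ : primeCount r ≡ suc j
  πr≡ with nthPrime≤-prime (prime b) (s≤s z≤n) j<πq
  ... | P-prime , πP≡ = trans (cong primeCount (prime∣prime^⇒≡ (exponent b) r-prime P-prime r∣Pᵛ)) πP≡
... | inj₂ r∣rest with encode-primeDivisor (suc j) bs rank r-prime r∣rest
...   | j<πr , πr≤ = ≤-trans (n≤1+n _) j<πr , ≤-trans πr≤ (≤-reflexive (sym (+-suc j (length bs))))

valuation-^* : ∀ {q m} v → Prime q → ¬ q ∣ m → valuation q (q ^ v * m) ≡ v
valuation-^* {q} {m} v q-prime q∤m = valuation-unique {q} {v} (prime>1 q-prime) (m , refl , q∤m)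

encode-injective : ∀ j bs bs′ → Rank j bs → Rank j bs′ → Diverge bs bs′ → encode j bs ≢ encode j bs′
encode-injective j (branch q v c ∷ bs) (branch q v′ c′ ∷ bs′) (j<πq , rank) (_ , rank′) (now v≢v′) eq =
  v≢v′ (begin
    v                                     ≡⟨ valuation-^* v P-prime (P∤ bs rank) ⟨
    valuation P (P ^ v * encode (suc j) bs)   ≡⟨ cong (valuation P) eq ⟩
    valuation P (P ^ v′ * encode (suc j) bs′) ≡⟨ valuation-^* v′ P-prime (P∤ bs′ rank′) ⟩
    v′                                    ∎)
  where
  open ≡-Reasoning
  P = nthPrime≤ q (suc j)
  P-prime = proj₁ (nthPrime≤-prime q (s≤s z≤n) j<πq)
  P∤ : ∀ cs → Rank (suc j) cs → ¬ P ∣ encode (suc j) cs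
  P∤ cs rank P∣ = <⇒≢ (proj₁ (encode-primeDivisor (suc j) cs rank P-prime P∣))
                       (sym (proj₂ (nthPrime≤-prime q (s≤s z≤n) j<πq)))
encode-injective j (branch q v c ∷ bs) (branch q v c′ ∷ bs′) (j<πq , rank) (_ , rank′) (later bs⋔bs′) eq =
  encode-injective (suc j) bs bs′ rank rank′ bs⋔bs′
    (*-cancelˡ-≡ _ _ (P ^ v) {{>-nonZero (1≤^ v (<⇒≤ (prime>1 P-prime)))}} eq)
  where
  P = nthPrime≤ q (suc j)
  P-prime = proj₁ (nthPrime≤-prime q (s≤s z≤n) j<πq)

ascending⇒All : ∀ {m} bs → Ascending m bs → All (λ b → m ≤ prime b × Prime (prime b)) bs
ascending⇒All []       _                       = []
ascending⇒All (b ∷ bs) (m≤q , q-prime , asc) =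
  (m≤q , q-prime) ∷ All.map (λ (q<q′ , q′-prime) → ≤-trans m≤q (<⇒≤ q<q′) , q′-prime) (ascending⇒All bs asc)

Exponents : ℕ → List Branch → Set
Exponents a = All (λ b → exponent b ≡ valuation (prime b) a)

separated⇒exponents : ∀ {a} bs → Separated a bs → Exponents a bs
separated⇒exponents []                  _                    = []
separated⇒exponents (branch q v c ∷ bs) (v≡ , _ , _ , sep) = v≡ ∷ separated⇒exponents bs sep

primePowers-∣ : ∀ {m a} bs → 1 ≤ a → Ascending m bs → Exponents a bs → primePowers bs ∣ a
primePowers-∣                   []                 _   _                      _           = 1∣ _
primePowers-∣ {a = a} (branch q v c ∷ bs) 1≤a (_ , q-prime , asc) (v≡ ∷ exps)
  with valuation-exact {q} {a} (prime>1 q-prime) 1≤a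
... | a′ , a≡ , q∤a′ = subst (_ ∣_) (sym a≡)
  (*-pres-∣ (subst (λ e → q ^ v ∣ q ^ e) v≡ ∣-refl)
            (primePowers-∣ {suc q} {a′} bs 1≤a′ asc
              (All.zipWith (λ {b} → transfer {b}) (exps , ascending⇒All {suc q} bs asc))))
  where
  1≤a′ : 1 ≤ a′
  1≤a′ = n≢0⇒n>0 λ { refl → contradiction (trans a≡ (*-zeroʳ (q ^ valuation q a))) (>⇒≢ 1≤a) }
  transfer : ∀ {b} → exponent b ≡ valuation (prime b) a × (suc q ≤ prime b × Prime (prime b))
           → exponent b ≡ valuation (prime b) a′
  transfer {b} (e≡ , q<q′ , q′-prime) = trans e≡ (begin
    valuation (prime b) a                                  ≡⟨ cong (valuation (prime b)) a≡ ⟩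
    valuation (prime b) (q ^ valuation q a * a′)
      ≡⟨ valuation-* q′-prime (1≤^ (valuation q a) (<⇒≤ (prime>1 q-prime))) 1≤a′ ⟩
    valuation (prime b) (q ^ valuation q a) + valuation (prime b) a′
      ≡⟨ cong (_+ valuation (prime b) a′) (valuation-prime^ (valuation q a) q′-prime q-prime (>⇒≢ q<q′)) ⟩
    valuation (prime b) a′                                 ∎)
    where open ≡-Reasoning

-- The monomials of degree r in the variables a ∷ cs, each listed once.
monomials : ℕ → List ℕ → ℕ → List ℕ
monomials a []       r       = [ a ^ r ]
monomials a (c ∷ cs) zero    = [ 1 ]
monomials a (c ∷ cs) (suc r) = map (c *_) (monomials a (c ∷ cs) r) ++ monomials a cs (suc r)

length-monomials : ∀ a cs r → length (monomials a cs r) ≡ (r + length cs) C length cs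
length-monomials a []       r       = refl
length-monomials a (c ∷ cs) zero    = sym (nCn≡1 (suc (length cs)))
length-monomials a (c ∷ cs) (suc r) = begin
  length (map (c *_) (monomials a (c ∷ cs) r) ++ monomials a cs (suc r))
    ≡⟨ length-++ (map (c *_) (monomials a (c ∷ cs) r)) ⟩
  length (map (c *_) (monomials a (c ∷ cs) r)) + length (monomials a cs (suc r))
    ≡⟨ cong₂ _+_ (trans (length-map (c *_) (monomials a (c ∷ cs) r)) (length-monomials a (c ∷ cs) r))
                 (length-monomials a cs (suc r)) ⟩
  (r + suc t) C suc t + (suc r + t) C t  ≡⟨ cong (λ n → n C suc t + (suc r + t) C t) (+-suc r t) ⟩
  (suc r + t) C suc t + (suc r + t) C t  ≡⟨ +-comm ((suc r + t) C suc t) _ ⟩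
  (suc r + t) C t + (suc r + t) C suc t  ≡⟨ nCk+nC[k+1]≡[n+1]C[k+1] (suc r + t) t ⟩
  suc (suc r + t) C suc t                ≡⟨ cong (λ n → suc n C suc t) (+-suc r t) ⟨
  (suc r + suc t) C suc t                ∎
  where
  open ≡-Reasoning
  t = length cs

monomials-ind : ∀ (Q : ℕ → ℕ → Set) a cs → Q 0 1 → (∀ {r y} → Q r y → Q (suc r) (a * y))
              → (∀ {r y c} → c ∈ cs → Q r y → Q (suc r) (c * y)) → ∀ {r y} → y ∈ monomials a cs r → Q r y
monomials-ind Q a [] Q1 Qa Qc {r} (here refl) = powers r
  where
  powers : ∀ r → Q r (a ^ r)
  powers zero    = Q1
  powers (suc r) = Qa (powers r)
monomials-ind Q a (c ∷ cs) Q1 Qa Qc {zero} (here refl) = Q1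
monomials-ind Q a (c ∷ cs) Q1 Qa Qc {suc r} y∈ =
  Sum.[ (λ y∈c* → let z , z∈ , y≡cz = ∈-map⁻ (c *_) y∈c* in
                  subst (Q (suc r)) (sym y≡cz) (Qc (here refl) (monomials-ind Q a (c ∷ cs) Q1 Qa Qc {r} z∈)))
      , monomials-ind Q a cs Q1 Qa (Qc ∘ there) {suc r}
      ]′ (∈-++⁻ (map (c *_) (monomials a (c ∷ cs) r)) y∈)

monomial-positive : ∀ {a cs r y} → 1 ≤ a → All (1 ≤_) cs → y ∈ monomials a cs r → 1 ≤ y
monomial-positive {a} {cs} 1≤a 1≤cs =
  monomials-ind (λ _ y → 1 ≤ y) a cs (s≤s z≤n) (1≤* 1≤a) (λ c∈ → 1≤* (All.lookup 1≤cs c∈))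

valuation-monomial : ∀ {q a cs v r y} → Prime q → 1 ≤ a → All (1 ≤_) cs → valuation q a ≡ v
                   → All (λ c → valuation q c ≡ v) cs → y ∈ monomials a cs r → valuation q y ≡ r * v
valuation-monomial {q} {a} {cs} {v} {r} q-prime 1≤a 1≤cs νa≡v νcs≡v y∈ =
  proj₂ (monomials-ind (λ r y → 1 ≤ y × valuation q y ≡ r * v) a cs (s≤s z≤n , valuation-1 (prime>1 q-prime))
    (λ {r} {y} (1≤y , νy≡) → 1≤* 1≤a 1≤y , trans (valuation-* q-prime 1≤a 1≤y) (cong₂ _+_ νa≡v νy≡))
    (λ c∈ (1≤y , νy≡) → 1≤* (All.lookup 1≤cs c∈) 1≤y ,
                         trans (valuation-* q-prime (All.lookup 1≤cs c∈) 1≤y) (cong₂ _+_ (All.lookup νcs≡v c∈) νy≡))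
    {r} y∈)

-- n counts the factors c of y; the equation says ν(y) = (r - n) ν(a) + n ν(c) without subtraction.
valuation-monomial-head : ∀ {q a c cs r y} → Prime q → 1 ≤ a → All (1 ≤_) (c ∷ cs)
                        → All (λ c′ → valuation q c′ ≡ valuation q a) cs → y ∈ monomials a (c ∷ cs) r
                        → ∃ λ n → valuation q y + n * valuation q a ≡ r * valuation q a + n * valuation q c
valuation-monomial-head {q} {a} {c} {cs} {r} q-prime 1≤a 1≤c∷cs νcs≡νa y∈ =
  proj₂ (monomials-ind Q a (c ∷ cs) (s≤s z≤n , 0 , trans (+-identityʳ _) (valuation-1 (prime>1 q-prime)))
    (λ {r} {y} (1≤y , n , eq) → 1≤* 1≤a 1≤y , n ,
                                 trans (cong (_+ n * va) (valuation-* q-prime 1≤a 1≤y)) (other (valuation q y) r n eq))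
    (λ {r} → multiply-by {r})
    {r} y∈)
  where
  va = valuation q a
  vc = valuation q c
  Q : ℕ → ℕ → Set
  Q r y = 1 ≤ y × ∃ λ n → valuation q y + n * va ≡ r * va + n * vc
  other : ∀ vy r n → vy + n * va ≡ r * va + n * vc → va + vy + n * va ≡ suc r * va + n * vc
  other vy r n eq = trans (+-assoc va vy (n * va)) (trans (cong (va +_) eq) (sym (+-assoc va (r * va) (n * vc))))
  head : ∀ vy r n → vy + n * va ≡ r * va + n * vc → vc + vy + suc n * va ≡ suc r * va + suc n * vc
  head vy r n eq = trans (regroup vc vy va n) (trans (cong (vc + va +_) eq) (collect vc va r n))
    where
    regroup : ∀ vc vy va n → vc + vy + suc n * va ≡ vc + va + (vy + n * va)
    regroup = solve-∀
    collect : ∀ vc va r n → vc + va + (r * va + n * vc) ≡ suc r * va + suc n * vc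
    collect = solve-∀
  multiply-by : ∀ {r y c′} → c′ ∈ c ∷ cs → Q r y → Q (suc r) (c′ * y)
  multiply-by {r} {y} (here refl) (1≤y , n , eq) =
    1≤* (All.head 1≤c∷cs) 1≤y , suc n ,
    trans (cong (_+ suc n * va) (valuation-* q-prime (All.head 1≤c∷cs) 1≤y)) (head (valuation q y) r n eq)
  multiply-by {r} {y} (there c′∈) (1≤y , n , eq) =
    1≤* (All.lookup 1≤c∷cs (there c′∈)) 1≤y , n ,
    trans (cong (_+ n * va) (trans (valuation-* q-prime (All.lookup 1≤c∷cs (there c′∈)) 1≤y)
                                   (cong (_+ valuation q y) (All.lookup νcs≡νa c′∈))))
          (other (valuation q y) r n eq)

cancel-valuations : ∀ va vc vz r n → vc + vz ≡ suc r * va → vz + n * va ≡ r * va + n * vc → vc ≡ va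
cancel-valuations va vc vz r n eq₁ eq₂ = *-cancelˡ-≡ vc va (suc n) (+-cancelʳ-≡ (r * va) _ _ (begin
  suc n * vc + r * va    ≡⟨ expand vc va r n ⟩
  vc + (r * va + n * vc) ≡⟨ cong (vc +_) eq₂ ⟨
  vc + (vz + n * va)     ≡⟨ +-assoc vc vz (n * va) ⟨
  vc + vz + n * va       ≡⟨ cong (_+ n * va) eq₁ ⟩
  suc r * va + n * va    ≡⟨ swap va r n ⟩
  suc n * va + r * va    ∎))
  where
  open ≡-Reasoning
  expand : ∀ vc va r n → suc n * vc + r * va ≡ vc + (r * va + n * vc)
  expand = solve-∀
  swap : ∀ va r n → suc r * va + n * va ≡ suc n * va + r * va
  swap = solve-∀

monomials-unique : ∀ {a m} bs r → 1 ≤ a → All (λ b → 1 ≤ witness b) bs → Ascending m bs → Separated a bs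
                 → Unique (monomials a (map witness bs) r)
monomials-unique []                  r       _   _    _   _ = [] ∷ []
monomials-unique (branch q v c ∷ bs) zero    _   _    _   _ = [] ∷ []
monomials-unique {a} (branch q v c ∷ bs) (suc r) 1≤a 1≤cs
                 asc@(_ , q-prime , asc′) sep@(v≡νa , νc≢v , agree , sep′) =
  Unique.++⁺ (Unique.map⁺ (*-cancelˡ-≡ _ _ c {{>-nonZero 1≤c}})
                          (monomials-unique (branch q v c ∷ bs) r 1≤a 1≤cs asc sep))
             (monomials-unique bs (suc r) 1≤a (All.tail 1≤cs) asc′ sep′)
             disjoint
  where
  1≤c = All.head 1≤cs
  νws≡νa : All (λ w → valuation q w ≡ valuation q a) (map witness bs)
  νws≡νa = AllP.map⁺ (All.map (λ νw≡v → trans νw≡v v≡νa) agree)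
  disjoint : ∀ {y} → ¬ (y ∈ map (c *_) (monomials a (c ∷ map witness bs) r)
                      × y ∈ monomials a (map witness bs) (suc r))
  disjoint (y∈c* , y∈rest) with ∈-map⁻ (c *_) y∈c*
  ... | z , z∈ , refl with valuation-monomial-head {r = r} q-prime 1≤a (AllP.map⁺ 1≤cs) νws≡νa z∈
  ...   | n , eq = νc≢v (trans (cancel-valuations (valuation q a) (valuation q c) (valuation q z) r n
                          (trans (sym (valuation-* q-prime 1≤c (monomial-positive {r = r} 1≤a (AllP.map⁺ 1≤cs) z∈)))
                                 (valuation-monomial {r = suc r} q-prime 1≤a (AllP.map⁺ (All.tail 1≤cs)) refl νws≡νa y∈rest))
                          eq) (sym v≡νa))

-- The first inequality

dependentPairs : ∀ {A B : Set} → List A → (A → List B) → List (A × B)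
dependentPairs []       f = []
dependentPairs (a ∷ as) f = map (a ,_) (f a) ++ dependentPairs as f

length-dependentPairs : ∀ {A B : Set} as (f : A → List B) → length (dependentPairs as f) ≡ sum (map (length ∘ f) as)
length-dependentPairs []       f = refl
length-dependentPairs (a ∷ as) f = trans (length-++ (map (a ,_) (f a)))
  (cong₂ _+_ (length-map (a ,_) (f a)) (length-dependentPairs as f))

∈-dependentPairs⁻ : ∀ {A B : Set} as {f : A → List B} {a b} → (a , b) ∈ dependentPairs as f → a ∈ as × b ∈ f a
∈-dependentPairs⁻ (a′ ∷ as) {f} ab∈ with ∈-++⁻ (map (a′ ,_) (f a′)) ab∈
... | inj₁ ab∈a′ with ∈-map⁻ (a′ ,_) ab∈a′
...   | _ , b∈ , refl = here refl , b∈
∈-dependentPairs⁻ (a′ ∷ as) ab∈ | inj₂ ab∈as = Product.map₁ there (∈-dependentPairs⁻ as ab∈as)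

dependentPairs-unique : ∀ {A B : Set} {as} {f : A → List B} → Unique as → (∀ a → Unique (f a))
                      → Unique (dependentPairs as f)
dependentPairs-unique {as = []}     _               _        = []
dependentPairs-unique {as = a ∷ as} {f} (a∉as ∷ unique) f-unique =
  Unique.++⁺ (Unique.map⁺ (cong proj₂) (f-unique a)) (dependentPairs-unique unique f-unique) disjoint
  where
  disjoint : ∀ {ab} → ¬ (ab ∈ map (a ,_) (f a) × ab ∈ dependentPairs as f)
  disjoint (ab∈a , ab∈as) with ∈-map⁻ (a ,_) ab∈a
  ... | _ , _ , refl = All.lookup a∉as (proj₁ (∈-dependentPairs⁻ as ab∈as)) refl

divℕ-exact : ∀ {h n} → 1 ≤ h → h ∣ n → n ≡ h * divℕ n h
divℕ-exact {suc h} {n} _ (divides m n≡m*h) = begin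
  n                  ≡⟨ n≡m*h ⟩
  m * suc h          ≡⟨ *-comm m (suc h) ⟩
  suc h * m          ≡⟨ cong (suc h *_) (m*n/n≡m m (suc h)) ⟨
  suc h * (m * suc h / suc h) ≡⟨ cong (λ x → suc h * (x / suc h)) n≡m*h ⟨
  suc h * (n / suc h) ∎
  where open ≡-Reasoning

divℕ-positive : ∀ {h n} → 1 ≤ h → 1 ≤ n → h ∣ n → 1 ≤ divℕ n h
divℕ-positive {h} {n} 1≤h 1≤n h∣n = n≢0⇒n>0 λ n/h≡0 →
  contradiction (trans (divℕ-exact 1≤h h∣n) (trans (cong (h *_) n/h≡0) (*-zeroʳ h))) (>⇒≢ 1≤n)

divℕ-involutive : ∀ {h n} → 1 ≤ h → 1 ≤ n → h ∣ n → divℕ n (divℕ n h) ≡ h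
divℕ-involutive {h} {n} 1≤h 1≤n h∣n with divℕ n h | divℕ-exact 1≤h h∣n | divℕ-positive 1≤h 1≤n h∣n
... | suc e | n≡h*e | _ = trans (cong (_/ suc e) n≡h*e) (m*n/n≡m h (suc e))

∈-divisors⁻ : ∀ {h k} → h ∈ divisors k → h ∣ k × 1 ≤ h
∈-divisors⁻ {k = k} h∈ with ∈-filter⁻ (_∣? k) {xs = range1 k} h∈
... | h∈range , h∣k = h∣k , proj₁ (∈-range1⁻ h∈range)

module _ {p k : ℕ} (1≤k : 1 ≤ k) (1≤p-1 : 1 ≤ p ∸ 1) (k∣p-1 : k ∣ p ∸ 1) where

  primitiveSolutions : ℕ → List ℕ
  primitiveSolutions h = filter (Xstar? h p) (range1 h)

  solutionPairs : List (ℕ × ℕ)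
  solutionPairs = dependentPairs (divisors k) primitiveSolutions

  sumT≡length-solutionPairs : sumT k p ≡ length solutionPairs
  sumT≡length-solutionPairs = begin
    sum (map (λ h → T (divℕ (p ∸ 1) h) p) (divisors k)) ≡⟨ cong sum (map-cong-local (All.tabulate T≡)) ⟩
    sum (map (λ h → Xstarcard h p) (divisors k))        ≡⟨ length-dependentPairs (divisors k) primitiveSolutions ⟨
    length solutionPairs                                 ∎
    where
    open ≡-Reasoning
    T≡ : ∀ {h} → h ∈ divisors k → T (divℕ (p ∸ 1) h) p ≡ Xstarcard h p
    T≡ h∈ with ∈-divisors⁻ h∈
    ... | h∣k , 1≤h = cong (λ n → Xstarcard n p) (divℕ-involutive 1≤h 1≤p-1 (∣-trans h∣k k∣p-1))

  ∈-solutionPairs⁻ : ∀ {h x} → (h , x) ∈ solutionPairs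
                   → h ∣ k × 1 ≤ h × 1 ≤ x × x ≤ h × gcd x h ≡ 1 × Cong h p x
  ∈-solutionPairs⁻ {h} hx∈ with ∈-dependentPairs⁻ (divisors k) hx∈
  ... | h∈ , x∈ with ∈-divisors⁻ h∈ | ∈-filter⁻ (Xstar? h p) {xs = range1 h} x∈
  ...   | h∣k , 1≤h | x∈range , gcd≡1 , cong =
    h∣k , 1≤h , proj₁ (∈-range1⁻ x∈range) , proj₂ (∈-range1⁻ x∈range) , gcd≡1 , cong

  scale : ℕ × ℕ → ℕ
  scale (h , x) = x * divℕ k h

  scale-∈ : ∀ {hx} → hx ∈ solutionPairs → scale hx ∈ filter (Cong? k p) (range1 k)
  scale-∈ {h , x} hx∈ with ∈-solutionPairs⁻ hx∈
  ... | h∣k , 1≤h , 1≤x , x≤h , _ , cong =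
    ∈-filter⁺ (Cong? k p) (∈-range1⁺ (1≤* 1≤x (divℕ-positive 1≤h 1≤k h∣k)) x*e≤k)
      (subst (λ n → Cong n p (x * divℕ k h)) (sym (divℕ-exact 1≤h h∣k)) (Cong-scale h x (divℕ k h) cong))
    where
    x*e≤k : x * divℕ k h ≤ k
    x*e≤k = subst (x * divℕ k h ≤_) (sym (divℕ-exact 1≤h h∣k)) (*-monoˡ-≤ (divℕ k h) x≤h)

  gcd-scale : ∀ {hx} → hx ∈ solutionPairs → gcd (scale hx) k ≡ divℕ k (proj₁ hx)
  gcd-scale {h , x} hx∈ with ∈-solutionPairs⁻ hx∈
  ... | h∣k , 1≤h , _ , _ , gcd≡1 , _ = begin
    gcd (x * e) k       ≡⟨ cong₂ gcd (*-comm x e) (trans (divℕ-exact 1≤h h∣k) (*-comm h e)) ⟩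
    gcd (e * x) (e * h) ≡⟨ c*gcd[m,n]≡gcd[cm,cn] e x h ⟨
    e * gcd x h         ≡⟨ cong (e *_) gcd≡1 ⟩
    e * 1               ≡⟨ *-identityʳ e ⟩
    e                   ∎
    where
    open ≡-Reasoning
    e = divℕ k h

  scale-injective : InjectiveOn scale solutionPairs
  scale-injective {h , x} {h′ , x′} hx∈ hx′∈ eq with ∈-solutionPairs⁻ hx∈ | ∈-solutionPairs⁻ hx′∈
  ... | h∣k , 1≤h , _ | h′∣k , 1≤h′ , _ = cong₂ _,_ h≡h′ x≡x′
    where
    e≡e′ : divℕ k h ≡ divℕ k h′
    e≡e′ = trans (sym (gcd-scale hx∈)) (trans (cong (λ n → gcd n k) eq) (gcd-scale hx′∈))
    instance
      e≢0 : NonZero (divℕ k h)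
      e≢0 = >-nonZero (divℕ-positive 1≤h 1≤k h∣k)
    h≡h′ : h ≡ h′
    h≡h′ = *-cancelʳ-≡ h h′ (divℕ k h)
      (trans (sym (divℕ-exact 1≤h h∣k)) (trans (divℕ-exact 1≤h′ h′∣k) (cong (h′ *_) (sym e≡e′))))
    x≡x′ : x ≡ x′
    x≡x′ = *-cancelʳ-≡ x x′ (divℕ k h) (trans eq (cong (x′ *_) (sym e≡e′)))

  sumT≤Xcard : sumT k p ≤ Xcard k p
  sumT≤Xcard = subst (_≤ Xcard k p) (sym sumT≡length-solutionPairs)
    (injectiveOn⇒length≤ (dependentPairs-unique (Unique.filter⁺ (_∣? k) (range1-unique k))
                                                (λ h → Unique.filter⁺ (Xstar? h p) (range1-unique h)))
                         scale-injective scale-∈)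

-- The second inequality

module _ {p k r₀ s : ℕ} (p-prime : Prime p) (1<k : 1 < k) (2kʳ⁰≤p : 2 * k ^ r₀ ≤ p)
         (s-maximal : ∀ s′ → (r₀ + s′) C s′ ≤ k → s′ ≤ s) where

  solutions : List ℕ
  solutions = filter (Cong? k p) (range1 k)

  ∈-solutions⁻ : ∀ {a} → a ∈ solutions → 1 ≤ a × a ≤ k × Cong k p a
  ∈-solutions⁻ a∈ with ∈-filter⁻ (Cong? k p) {xs = range1 k} a∈
  ... | a∈range , cong = proj₁ (∈-range1⁻ a∈range) , proj₂ (∈-range1⁻ a∈range) , cong

  D : ℤ.ℤ
  D = (ℤ.- ℤ.+ k) ℤ.^ k

  branchesOf : ℕ → List Branch
  branchesOf a = branches a solutions 1 k

  branchesOf-ascending : ∀ a → Ascending 1 (branchesOf a)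
  branchesOf-ascending a = branches-ascending a solutions 1 k

  branchesOf-rank : ∀ a → Rank 0 (branchesOf a)
  branchesOf-rank a = ascending⇒rank (branchesOf a) (branchesOf-ascending a)

  witnesses : ℕ → List ℕ
  witnesses a = map witness (branchesOf a)

  witnesses∈ : ∀ a → All (_∈ solutions) (witnesses a)
  witnesses∈ a = AllP.map⁺ (branches-witness∈ a solutions 1 k)

  kʳ⁰<p : k ^ r₀ < p
  kʳ⁰<p = <-≤-trans (m<m+n (k ^ r₀) (1≤^ r₀ (<⇒≤ 1<k)))
                    (subst (_≤ p) (cong (k ^ r₀ +_) (+-identityʳ (k ^ r₀))) 2kʳ⁰≤p)

  length-branchesOf≤s : ∀ {a} → a ∈ solutions → length (branchesOf a) ≤ s
  length-branchesOf≤s {a} a∈ = s-maximal t (begin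
    (r₀ + t) C t
      ≡⟨ trans (length-monomials a (witnesses a) r₀) (cong (λ n → (r₀ + n) C n) (length-map witness Bs)) ⟨
    length L        ≤⟨ power-fibre≤degree p-prime (<⇒≤ 1<k) (D ℤ.^ r₀) L L-unique L<p L-solves ⟩
    k               ∎)
    where
    open ≤-Reasoning
    Bs = branchesOf a
    t = length Bs
    L = monomials a (witnesses a) r₀
    1≤a = proj₁ (∈-solutions⁻ a∈)
    L-unique = monomials-unique Bs r₀ 1≤a (All.map (proj₁ ∘ ∈-solutions⁻) (branches-witness∈ a solutions 1 k))
                 (branchesOf-ascending a) (branches-separated a solutions 1 k)
    L-bounded : ∀ {r y} → y ∈ monomials a (witnesses a) r → y ≤ k ^ r
    L-bounded = monomials-ind (λ r y → y ≤ k ^ r) a (witnesses a) ≤-refl (*-mono-≤ (proj₁ (proj₂ (∈-solutions⁻ a∈))))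
                  (λ c∈ → *-mono-≤ (proj₁ (proj₂ (∈-solutions⁻ (All.lookup (witnesses∈ a) c∈)))))
    L<p = All.tabulate (λ y∈ → ≤-<-trans (L-bounded {r₀} y∈) kʳ⁰<p)
    L-solves′ : ∀ {r y} → y ∈ monomials a (witnesses a) r → ((ℤ.+ y) ℤ.^ k) ≡ (D ℤ.^ r) [mod p ]
    L-solves′ = monomials-ind (λ r y → ((ℤ.+ y) ℤ.^ k) ≡ (D ℤ.^ r) [mod p ]) a (witnesses a)
      (subst (λ z → z ≡ ℤ.1ℤ [mod p ]) (sym (ℤ.^-zeroˡ k)) (≡-mod-refl {p} ℤ.1ℤ))
      (λ {r} {y} → ^-≡-mod-* {p} {a} {y} {D} {D ℤ.^ r} k (proj₂ (proj₂ (∈-solutions⁻ a∈))))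
      (λ {r} {y} {c} c∈ → ^-≡-mod-* {p} {c} {y} {D} {D ℤ.^ r} k
                            (proj₂ (proj₂ (∈-solutions⁻ (All.lookup (witnesses∈ a) c∈)))))
    L-solves = All.tabulate (L-solves′ {r₀})

  code : ℕ → ℕ
  code a = encode 0 (branchesOf a)

  code-bounds : ∀ {a} → a ∈ solutions → 1 ≤ code a × code a ≤ k
  code-bounds {a} a∈ with ∈-solutions⁻ a∈
  ... | 1≤a , a≤k , _ = encode-positive 0 (branchesOf a) (branchesOf-rank a) , (begin
    code a                    ≤⟨ encode≤primePowers 0 (branchesOf a) (branchesOf-rank a) ⟩
    primePowers (branchesOf a) ≤⟨ ∣⇒≤ {{>-nonZero 1≤a}} (primePowers-∣ (branchesOf a) 1≤a (branchesOf-ascending a)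
                                   (separated⇒exponents (branchesOf a) (branches-separated a solutions 1 k))) ⟩
    a                         ≤⟨ a≤k ⟩
    k                         ∎)
    where open ≤-Reasoning

  code-smooth : ∀ {a} → a ∈ solutions → Smooth s (code a)
  code-smooth {a} a∈ q q-prime q∣ =
    ≤-trans (proj₂ (encode-primeDivisor 0 (branchesOf a) (branchesOf-rank a) q-prime q∣)) (length-branchesOf≤s a∈)

  code-injective : InjectiveOn code solutions
  code-injective {a} {b} a∈ b∈ eq with a ≟ b
  ... | yes a≡b = a≡b
  ... | no  a≢b with ≢⇒valuationsDiffer a (proj₁ (∈-solutions⁻ a∈)) (proj₁ (∈-solutions⁻ b∈)) a≢b
  ...   | q , q-prime , q∣a⊎b , νa≢νb = contradiction eq
    (encode-injective 0 (branchesOf a) (branchesOf b) (branchesOf-rank a) (branchesOf-rank b)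
      (branches-diverge solutions 1 k a∈ b∈ q-prime (<⇒≤ (prime>1 q-prime)) (s≤s q≤k) νa≢νb))
    where
    ∣⇒≤k : ∀ {n} → n ∈ solutions → q ∣ n → q ≤ k
    ∣⇒≤k n∈ q∣n = ≤-trans (∣⇒≤ {{>-nonZero (proj₁ (∈-solutions⁻ n∈))}} q∣n) (proj₁ (proj₂ (∈-solutions⁻ n∈)))
    q≤k = Sum.[ ∣⇒≤k a∈ , ∣⇒≤k b∈ ]′ q∣a⊎b

  Xcard≤Ψ : Xcard k p ≤ Ψ k s
  Xcard≤Ψ = injectiveOn⇒length≤ (Unique.filter⁺ (Cong? k p) (range1-unique k))
    (λ a∈ b∈ eq → code-injective a∈ b∈ (trans (sym (code-suc-pred a∈)) (trans (cong suc eq) (code-suc-pred b∈))))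
    (λ a∈ → ∈-filter⁺ (Smooth? s) (∈-upTo⁺ (subst (_≤ k) (sym (code-suc-pred a∈)) (proj₂ (code-bounds a∈))))
                                    (subst (Smooth s) (sym (code-suc-pred a∈)) (code-smooth a∈)))
    where
    code-suc-pred : ∀ {a} → a ∈ solutions → suc (pred (code a)) ≡ code a
    code-suc-pred a∈ = suc-pred _ {{>-nonZero (proj₁ (code-bounds a∈))}}

corollary5p3 : (p k r₀ s : ℕ) → Prime p → 2 < p → k ∣ (p ∸ 1) → 1 < k → 2 * k < p
    → (2 * k ^ r₀ ≤ p) → ((r : ℕ) → 2 * k ^ r ≤ p → r ≤ r₀)
    → ((r₀ + s) C s ≤ k) → ((s′ : ℕ) → (r₀ + s′) C s′ ≤ k → s′ ≤ s)
    → (sumT k p ≤ Xcard k p) × (Xcard k p ≤ Ψ k s)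
corollary5p3 p k r₀ s p-prime 2<p k∣p-1 1<k _ 2kʳ⁰≤p _ _ s-maximal =
  sumT≤Xcard (<⇒≤ 1<k) (m<n⇒0<n∸m (<⇒≤ 2<p)) k∣p-1 , Xcard≤Ψ p-prime 1<k 2kʳ⁰≤p s-maximal
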